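{- Let $G$ be a simple cubic graph with a polyhedral embedding $\Pi$ and extended graph $G^e=G^e(\Pi)$. Let $\mathcal P_1=(u\,t_0\,t_1\,v)$, $\mathcal P_2=(u\,t_2\,t_3\,v)$, $\mathcal P_3=(u\,t_4\,t_5\,v)$ be three pairwise internally disjoint $3$-paths in $G$ such that $[uv]$ is a scaffold edge of $G^e$. Then $[uv]$ is a double scaffold edge (multiplicity $2$), and $\mathcal P_i\cup\mathcal P_j$ is a $\Pi$-facial cycle for some pair $i\ne j$ in $\{1,2,3\}$.
   Context: An embedding of a graph in a surface without boundary is polyhedral if every facial walk is a cycle and any two distinct facial cycles intersect in either the empty set, a single vertex, or a single edge. A $\Pi$-facial subwalk is a walk formed by consecutive vertices of some $\Pi$-facial cycle. The extended graph $G^e(\Pi)$ has vertex set $V(G)$ and edge set $E(G)$ together with a multiset $\mathcal S$ of scaffold edges: for distinct vertices $t_0,t_3$, the scaffold edge $[t_0t_3]$ appears with multiplicity equal to the number of paths $(t_0t_1t_2t_3)$ of $G$ that are $\Pi$-facial subwalks; it is a double scaffold edge if this multiplicity is $2$. -}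

module Defs where

open import Data.Nat using (ℕ; zero; suc)
open import Data.Fin using (Fin; zero; suc; _≟_)
open import Data.Bool using (Bool; true; false; _xor_; if_then_else_)
open import Data.Product using (Σ; ∃; ∃-syntax; _×_; _,_)
open import Data.Sum using (_⊎_)
open import Relation.Binary.PropositionalEquality using (_≡_; _≢_)
open import Relation.Nullary using (¬_; yes; no)

_⟺_ : Set → Set → Set
A ⟺ B = (A → B) × (B → A)

record Graph (n : ℕ) : Set₁ where
  field
    Adj    : Fin n → Fin n → Set
    sym    : ∀ {x y} → Adj x y → Adj y x
    irrefl : ∀ {x} → ¬ Adj x x
open Graph public

Cubic : ∀ {n} → Graph n → Set
Cubic {n} G = ∀ v → Σ (Fin 3 → Fin n) λ f →
  (∀ i j → f i ≡ f j → i ≡ j) × (∀ w → Adj G v w ⟺ (∃[ i ] f i ≡ w))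

data Reach {n} (G : Graph n) : Fin n → Fin n → Set where
  here : ∀ {x} → Reach G x x
  there : ∀ {x y z} → Adj G x y → Reach G y z → Reach G x z

Connected : ∀ {n} → Graph n → Set
Connected {n} G = ∀ (x y : Fin n) → Reach G x y

Path3 : ∀ {n} → Graph n → Fin n → Fin n → Fin n → Fin n → Set
Path3 G a b c d =
  (a ≢ b × a ≢ c × a ≢ d × b ≢ c × b ≢ d × c ≢ d) ×
  Adj G a b × Adj G b c × Adj G c d

-- The local rotation π_v is given by an enumeration rot v : Fin 3 → N(v),
-- with π_v (rot v i) = rot v (i + 1 mod 3).  sig x y = true means the
-- edge xy has signature -1.

record Scheme {n} (G : Graph n) : Set where
  field
    rot     : Fin n → Fin 3 → Fin n
    rot-inj : ∀ v i j → rot v i ≡ rot v j → i ≡ j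
    rot-nb  : ∀ v w → Adj G v w ⟺ (∃[ i ] rot v i ≡ w)
    sig     : Fin n → Fin n → Bool
    sig-sym : ∀ x y → sig x y ≡ sig y x
open Scheme public

suc3 : Fin 3 → Fin 3
suc3 zero = suc zero
suc3 (suc zero) = suc (suc zero)
suc3 (suc (suc zero)) = zero

pred3 : Fin 3 → Fin 3
pred3 zero = suc (suc zero)
pred3 (suc zero) = zero
pred3 (suc (suc zero)) = suc zero

-- index of x in the rotation at w (meaningful when x is a neighbour of w)
idx : ∀ {n} → (Fin 3 → Fin n) → Fin n → Fin 3
idx r x with r zero ≟ x
... | yes _ = zero
... | no _ with r (suc zero) ≟ x
...   | yes _ = suc zero
...   | no _ = suc (suc zero)

-- face-tracing states: (current vertex, index of outgoing edge, local orientation)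
State : ℕ → Set
State n = Fin n × Fin 3 × Bool

vertex : ∀ {n} → State n → Fin n
vertex (v , _ , _) = v

-- one step of the (Mohar–Thomassen) face traversal procedure
step : ∀ {n} {G : Graph n} → Scheme G → State n → State n
step Π (v , i , s) =
  let w  = rot Π v i
      s' = s xor sig Π v w
      j  = idx (rot Π w) v
  in w , (if s' then suc3 j else pred3 j) , s'

iter : ∀ {n} {G : Graph n} → Scheme G → ℕ → State n → State n
iter Π zero s = s
iter Π (suc k) s = step Π (iter Π k s)

wv : ∀ {n} {G : Graph n} → Scheme G → State n → ℕ → Fin n
wv Π s k = vertex (iter Π k s)

VIn : ∀ {n} {G : Graph n} → Scheme G → State n → Fin n → Set
VIn Π s x = ∃[ k ] wv Π s k ≡ x

EIn : ∀ {n} {G : Graph n} → Scheme G → State n → Fin n → Fin n → Set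
EIn Π s x y = ∃[ k ] ((wv Π s k ≡ x × wv Π s (suc k) ≡ y) ⊎ (wv Π s k ≡ y × wv Π s (suc k) ≡ x))

-- every facial walk is a cycle: it never revisits a vertex before closing up
FacialWalksAreCycles : ∀ {n} {G : Graph n} → Scheme G → Set
FacialWalksAreCycles Π = ∀ s k → wv Π s k ≡ wv Π s 0 → iter Π k s ≡ s

SameCycle : ∀ {n} {G : Graph n} → Scheme G → State n → State n → Set
SameCycle {n} Π s s' = ∀ (x y : Fin n) → EIn Π s x y ⟺ EIn Π s' x y

IntersectionOK : ∀ {n} {G : Graph n} → Scheme G → State n → State n → Set
IntersectionOK {n} Π s s' =
  (∀ x → ¬ Common x) ⊎
  (∃[ x ] (∀ z → Common z ⟺ (z ≡ x))) ⊎
  (∃[ x ] ∃[ y ] (x ≢ y × (∀ z → Common z ⟺ (z ≡ x ⊎ z ≡ y)) ×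
                   EIn Π s x y × EIn Π s' x y))
  where
  Common : Fin n → Set
  Common z = VIn Π s z × VIn Π s' z

Polyhedral : ∀ {n} {G : Graph n} → Scheme G → Set
Polyhedral Π = FacialWalksAreCycles Π ×
  (∀ s s' → ¬ SameCycle Π s s' → IntersectionOK Π s s')

FacialSubwalk : ∀ {n} {G : Graph n} → Scheme G → Fin n → Fin n → Fin n → Fin n → Set
FacialSubwalk Π a b c d = ∃[ s ] (wv Π s 0 ≡ a × wv Π s 1 ≡ b × wv Π s 2 ≡ c × wv Π s 3 ≡ d)

-- (b , c) witnesses one copy of the scaffold edge [uv]:
-- (u b c v) is a path of G and a Π-facial subwalk
ScaffoldWitness : ∀ {n} {G : Graph n} → Scheme G → Fin n → Fin n → Fin n × Fin n → Set
ScaffoldWitness {G = G} Π u v (b , c) = Path3 G u b c v × FacialSubwalk Π u b c v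

IsScaffoldEdge : ∀ {n} {G : Graph n} → Scheme G → Fin n → Fin n → Set
IsScaffoldEdge Π u v = u ≢ v × ∃[ p ] ScaffoldWitness Π u v p

IsDoubleScaffoldEdge : ∀ {n} {G : Graph n} → Scheme G → Fin n → Fin n → Set
IsDoubleScaffoldEdge Π u v = u ≢ v × ∃[ p ] ∃[ q ] (p ≢ q ×
  ScaffoldWitness Π u v p × ScaffoldWitness Π u v q ×
  (∀ r → ScaffoldWitness Π u v r → r ≡ p ⊎ r ≡ q))

FacialHexagon : ∀ {n} {G : Graph n} → Scheme G → Fin n → Fin n → Fin n → Fin n → Fin n → Fin n → Set
FacialHexagon Π a b c d e f = ∃[ s ] (wv Π s 0 ≡ a × wv Π s 1 ≡ b × wv Π s 2 ≡ c ×
  wv Π s 3 ≡ d × wv Π s 4 ≡ e × wv Π s 5 ≡ f × iter Π 6 s ≡ s)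

Disjoint2 : ∀ {n} → Fin n → Fin n → Fin n → Fin n → Set
Disjoint2 a b c d = a ≢ c × a ≢ d × b ≢ c × b ≢ d

-- The three paths
-- (u t₀ t₁ v), (u t₂ t₃ v), (u t₄ t₅ v) use all three neighbours of u and of v, so the
-- facial subwalk (u b c v) witnessing [uv] has b ∈ {t₀,t₂,t₄} and c ∈ {t₁,t₃,t₅}.
-- The engine of the proof is polyhedrality: two faces sharing three vertices (or two
-- non-adjacent ones) coincide, and then every edge of one lies on the other, so its
-- endpoints are consecutive on both.  Coincidence of faces is
-- obtained only doubly negated; it is used to refute configurations, or for decidable goals.
module Submission where

open import Defs hiding (sym)
open import Data.Nat using (ℕ; zero; suc; _+_; _≤_)
open import Data.Nat.Properties using (≤-total; +-comm; m≤n⇒∃[o]m+o≡n)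
open import Data.Fin using (Fin; zero; suc; _≟_)
open import Data.Bool using (Bool; true; false; _xor_; if_then_else_)
open import Data.Bool.Properties using (xor-assoc; xor-same; xor-identityʳ)
open import Data.Product using (_×_; _,_; proj₁; proj₂; ∃-syntax)
open import Data.Product.Properties using (≡-dec)
open import Data.Sum as Sum using (_⊎_; inj₁; inj₂; [_,_]′)
open import Data.Empty using (⊥; ⊥-elim)
open import Function using (_∘_)
open import Relation.Nullary using (¬_)
open import Relation.Nullary.Decidable using (yes; no; Dec; _×-dec_; _⊎-dec_; decidable-stable)
open import Relation.Nullary.Negation using (¬¬-map)
open import Relation.Binary.PropositionalEquality
  using (_≡_; _≢_; refl; sym; trans; cong; cong₂; subst; subst₂; ≢-sym; module ≡-Reasoning)

pattern f0 = zero
pattern f1 = suc zero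
pattern f2 = suc (suc zero)

turn : Bool → Fin 3 → Fin 3
turn σ j = if σ then suc3 j else pred3 j

-- The inverse move, used to recover the vertex a state was entered from.
unturn : Bool → Fin 3 → Fin 3
unturn σ i = if σ then pred3 i else suc3 i

unturn-turn : ∀ σ j → unturn σ (turn σ j) ≡ j
unturn-turn true  f0 = refl
unturn-turn true  f1 = refl
unturn-turn true  f2 = refl
unturn-turn false f0 = refl
unturn-turn false f1 = refl
unturn-turn false f2 = refl

turn-unturn : ∀ σ i → turn σ (unturn σ i) ≡ i
turn-unturn true  f0 = refl
turn-unturn true  f1 = refl
turn-unturn true  f2 = refl
turn-unturn false f0 = refl
turn-unturn false f1 = refl
turn-unturn false f2 = refl

-- A turn never returns to the arrival index: this is why faces do not backtrack.
turn-moves : ∀ σ j → turn σ j ≢ j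
turn-moves true  f0 ()
turn-moves true  f1 ()
turn-moves true  f2 ()
turn-moves false f0 ()
turn-moves false f1 ()
turn-moves false f2 ()

turn-onto : ∀ j l → l ≢ j → ∃[ σ ] turn σ j ≡ l
turn-onto f0 f0 l≢j = ⊥-elim (l≢j refl)
turn-onto f0 f1 _   = true , refl
turn-onto f0 f2 _   = false , refl
turn-onto f1 f0 _   = false , refl
turn-onto f1 f1 l≢j = ⊥-elim (l≢j refl)
turn-onto f1 f2 _   = true , refl
turn-onto f2 f0 _   = true , refl
turn-onto f2 f1 _   = false , refl
turn-onto f2 f2 l≢j = ⊥-elim (l≢j refl)

bool-exhaust : ∀ {σ τ : Bool} → σ ≢ τ → ∀ ρ → ρ ≡ σ ⊎ ρ ≡ τ
bool-exhaust {true}  {true}  σ≢τ _     = ⊥-elim (σ≢τ refl)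
bool-exhaust {false} {false} σ≢τ _     = ⊥-elim (σ≢τ refl)
bool-exhaust {true}  {false} _   true  = inj₁ refl
bool-exhaust {true}  {false} _   false = inj₂ refl
bool-exhaust {false} {true}  _   true  = inj₂ refl
bool-exhaust {false} {true}  _   false = inj₁ refl

OneOf : ∀ {A : Set} → A → A → A → A → Set
OneOf x a b c = x ≡ a ⊎ x ≡ b ⊎ x ≡ c

fin3-exhaust : ∀ {i j k} → i ≢ j → i ≢ k → j ≢ k → ∀ l → OneOf l i j k
fin3-exhaust {i} {j} {k} i≢j i≢k j≢k l with l ≟ i
... | yes l≡i = inj₁ l≡i
... | no l≢i with turn-onto i j (≢-sym i≢j) | turn-onto i k (≢-sym i≢k) | turn-onto i l l≢i
... | σ , refl | τ , refl | ρ , refl =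
  inj₂ (Sum.map (cong (λ α → turn α i)) (cong (λ α → turn α i))
                (bool-exhaust (λ σ≡τ → j≢k (cong (λ α → turn α i) σ≡τ)) ρ))

last-index : ∀ (k : Fin 3) → k ≢ f0 → k ≢ f1 → f2 ≡ k
last-index f0 k≢0 _ = ⊥-elim (k≢0 refl)
last-index f1 _ k≢1 = ⊥-elim (k≢1 refl)
last-index f2 _ _   = refl

-- Crossing an edge twice restores the local orientation.
xor-cancelʳ : ∀ σ τ → (σ xor τ) xor τ ≡ σ
xor-cancelʳ σ τ = trans (xor-assoc σ τ τ) (trans (cong (σ xor_) (xor-same τ)) (xor-identityʳ σ))

distinct-in-pair : ∀ {A : Set} {a b x y : A} → a ≡ x ⊎ a ≡ y → b ≡ x ⊎ b ≡ y → a ≢ b →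
                   (a ≡ x × b ≡ y) ⊎ (a ≡ y × b ≡ x)
distinct-in-pair (inj₁ p)    (inj₂ q)    _   = inj₁ (p , q)
distinct-in-pair (inj₂ p)    (inj₁ q)    _   = inj₂ (p , q)
distinct-in-pair (inj₁ refl) (inj₁ refl) a≢b = ⊥-elim (a≢b refl)
distinct-in-pair (inj₂ refl) (inj₂ refl) a≢b = ⊥-elim (a≢b refl)

no-three-in-pair : ∀ {A : Set} {a b c x y : A} → a ≡ x ⊎ a ≡ y → b ≡ x ⊎ b ≡ y → c ≡ x ⊎ c ≡ y →
                   a ≢ b → a ≢ c → b ≢ c → ⊥
no-three-in-pair a∈ b∈ c∈ a≢b a≢c b≢c with distinct-in-pair a∈ b∈ a≢b | c∈
... | inj₁ (refl , refl) | inj₁ refl = a≢c refl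
... | inj₁ (refl , refl) | inj₂ refl = b≢c refl
... | inj₂ (refl , refl) | inj₁ refl = b≢c refl
... | inj₂ (refl , refl) | inj₂ refl = a≢c refl

module FaceTracing {n : ℕ} {G : Graph n} (Π : Scheme G) where

  ~-sym : ∀ {x y} → Adj G x y → Adj G y x
  ~-sym = Graph.sym G

  adj⇒≢ : ∀ {x y} → Adj G x y → x ≢ y
  adj⇒≢ x~y refl = irrefl G x~y

  rot-adj : ∀ v i → Adj G v (rot Π v i)
  rot-adj v i = proj₂ (rot-nb Π v (rot Π v i)) (i , refl)

  rot-index : ∀ {v w} → Adj G v w → ∃[ i ] rot Π v i ≡ w
  rot-index {v} {w} = proj₁ (rot-nb Π v w)

  idx-correct : ∀ v {x} k → rot Π v k ≡ x → idx (rot Π v) x ≡ k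
  idx-correct v {x} k e with rot Π v f0 ≟ x
  ... | yes e₀ = rot-inj Π v f0 k (trans e₀ (sym e))
  ... | no ne₀ with rot Π v f1 ≟ x
  ...   | yes e₁ = rot-inj Π v f1 k (trans e₁ (sym e))
  ...   | no ne₁ = last-index k (λ k≡0 → ne₀ (subst (λ i → rot Π v i ≡ x) k≡0 e))
                                (λ k≡1 → ne₁ (subst (λ i → rot Π v i ≡ x) k≡1 e))

  idx-rot : ∀ w j → idx (rot Π w) (rot Π w j) ≡ j
  idx-rot w j = idx-correct w j refl

  rot-idx : ∀ {w v} → Adj G w v → rot Π w (idx (rot Π w) v) ≡ v
  rot-idx {w} w~v with rot-index w~v
  ... | k , refl = cong (rot Π w) (idx-rot w k)

  neighbours-exhausted : ∀ {w x y z q} → Adj G w x → Adj G w y → Adj G w z →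
                         x ≢ y → x ≢ z → y ≢ z → Adj G w q → OneOf q x y z
  neighbours-exhausted {w} w~x w~y w~z x≢y x≢z y≢z w~q
    with rot-index w~x | rot-index w~y | rot-index w~z | rot-index w~q
  ... | i , refl | j , refl | k , refl | l , refl =
    Sum.map (cong (rot Π w)) (Sum.map (cong (rot Π w)) (cong (rot Π w)))
      (fin3-exhaust (x≢y ∘ cong (rot Π w)) (x≢z ∘ cong (rot Π w)) (y≢z ∘ cong (rot Π w)) l)

  walk-adj : ∀ s k → Adj G (wv Π s k) (wv Π s (suc k))
  walk-adj s k with iter Π k s
  ... | v , i , _ = rot-adj v i

  adj-succ : ∀ F k {x} → wv Π F k ≡ x → Adj G x (wv Π F (suc k))
  adj-succ F k e = subst (λ z → Adj G z (wv Π F (suc k))) e (walk-adj F k)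

  adj-pred : ∀ F k {x} → wv Π F (suc k) ≡ x → Adj G x (wv Π F k)
  adj-pred F k e = subst (λ z → Adj G z (wv Π F k)) e (~-sym (walk-adj F k))

  step-no-return : ∀ t → vertex t ≢ vertex (step Π (step Π t))
  step-no-return (v , i , σ) v≡next =
    turn-moves _ _ (sym (rot-inj Π (rot Π v i) _ _ (trans (rot-idx (~-sym (rot-adj v i))) v≡next)))

  no-backtrack : ∀ s k → wv Π s k ≢ wv Π s (suc (suc k))
  no-backtrack s k = step-no-return (iter Π k s)

  entered-from : State n → Fin n
  entered-from (v , i , σ) = rot Π v (unturn σ i)

  entered-from-step : ∀ t → entered-from (step Π t) ≡ vertex t
  entered-from-step (v , i , σ) =
    trans (cong (rot Π (rot Π v i)) (unturn-turn (σ xor sig Π v (rot Π v i)) _))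
          (rot-idx (~-sym (rot-adj v i)))

  state-≡ : ∀ {v v' : Fin n} {i i' : Fin 3} {σ σ' : Bool} →
            v ≡ v' → i ≡ i' → σ ≡ σ' → _≡_ {A = State n} (v , i , σ) (v' , i' , σ')
  state-≡ refl refl refl = refl

  -- Every state has a predecessor: traverse the entering edge from its other end.
  step-onto : ∀ t → ∃[ t' ] step Π t' ≡ t
  step-onto (a , i , σ) = (x , idx (rot Π x) a , τ) , state-≡ back-at-a same-index same-orientation
    where
    open ≡-Reasoning
    x = rot Π a (unturn σ i)
    τ = σ xor sig Π x a
    a' = rot Π x (idx (rot Π x) a)
    back-at-a : a' ≡ a
    back-at-a = rot-idx (~-sym (rot-adj a (unturn σ i)))
    same-orientation : τ xor sig Π x a' ≡ σ
    same-orientation = trans (cong (λ z → τ xor sig Π x z) back-at-a) (xor-cancelʳ σ _)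
    same-index : turn (τ xor sig Π x a') (idx (rot Π a') x) ≡ i
    same-index = begin
      turn (τ xor sig Π x a') (idx (rot Π a') x)
        ≡⟨ cong₂ turn same-orientation (cong (λ z → idx (rot Π z) x) back-at-a) ⟩
      turn σ (idx (rot Π a) x)
        ≡⟨ cong (turn σ) (idx-rot a (unturn σ i)) ⟩
      turn σ (unturn σ i)
        ≡⟨ turn-unturn σ i ⟩
      i ∎

  iter-+ : ∀ d a s → iter Π (d + a) s ≡ iter Π d (iter Π a s)
  iter-+ zero    a s = refl
  iter-+ (suc d) a s = cong (step Π) (iter-+ d a s)

  iter-step : ∀ k s → iter Π (suc k) s ≡ iter Π k (step Π s)
  iter-step zero    s = refl
  iter-step (suc k) s = cong (step Π) (iter-step k s)

  wv-iter : ∀ d a s → wv Π (iter Π a s) d ≡ wv Π s (d + a)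
  wv-iter d a s = cong vertex (sym (iter-+ d a s))

  rewind : ∀ m s → ∃[ s' ] (∀ k → wv Π s' (m + k) ≡ wv Π s k)
  rewind zero s = s , λ k → refl
  rewind (suc m) s with rewind m s
  ... | s₁ , s₁≈s with step-onto s₁
  ...   | s₂ , refl = s₂ , λ k → trans (cong vertex (iter-step (m + k) s₂)) (s₁≈s k)

  periodic : ∀ p h → iter Π p h ≡ h → ∀ k → wv Π h (k + p) ≡ wv Π h k
  periodic p h per k = trans (sym (wv-iter k p h)) (cong (λ t → wv Π t k) per)

  shift-periodic : ∀ p h → iter Π p h ≡ h → ∀ m → iter Π p (iter Π m h) ≡ iter Π m h
  shift-periodic p h per m = begin
    iter Π p (iter Π m h)  ≡⟨ sym (iter-+ p m h) ⟩
    iter Π (p + m) h       ≡⟨ cong (λ k → iter Π k h) (+-comm p m) ⟩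
    iter Π (m + p) h       ≡⟨ iter-+ m p h ⟩
    iter Π m (iter Π p h)  ≡⟨ cong (iter Π m) per ⟩
    iter Π m h             ∎
    where open ≡-Reasoning

  hexagon-from : ∀ F {a b c d e f} m → iter Π 6 F ≡ F →
    wv Π F m ≡ a → wv Π F (1 + m) ≡ b → wv Π F (2 + m) ≡ c →
    wv Π F (3 + m) ≡ d → wv Π F (4 + m) ≡ e → wv Π F (5 + m) ≡ f → FacialHexagon Π a b c d e f
  hexagon-from F m per ea eb ec ed ee ef =
    iter Π m F , trans (wv-iter 0 m F) ea , trans (wv-iter 1 m F) eb , trans (wv-iter 2 m F) ec ,
    trans (wv-iter 3 m F) ed , trans (wv-iter 4 m F) ee , trans (wv-iter 5 m F) ef , shift-periodic 6 F per m

  FacialAngle : Fin n → Fin n → Fin n → Set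
  FacialAngle a w c = ∃[ s ] (wv Π s 0 ≡ a × wv Π s 1 ≡ w × wv Π s 2 ≡ c)

  -- Every path (a w c) is a facial subwalk: leave a towards w with the orientation
  -- that makes the traversal turn from a to c at w.
  angle-facial : ∀ {a w c} → Adj G a w → Adj G w c → a ≢ c → FacialAngle a w c
  angle-facial {a} {_} {c} a~w w~c a≢c with rot-index a~w | rot-index w~c
  ... | i , refl | l , w[l]≡c = from-turn (turn-onto j l l≢j)
    where
    w = rot Π a i
    j = idx (rot Π w) a
    l≢j : l ≢ j
    l≢j l≡j = a≢c (trans (sym (rot-idx (~-sym a~w))) (trans (cong (rot Π w) (sym l≡j)) w[l]≡c))
    from-turn : ∃[ σ ] turn σ j ≡ l → FacialAngle a w c
    from-turn (σ , turn≡l) = (a , i , σ xor sig Π a w) , refl , refl ,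
      trans (cong (rot Π w) (trans (cong (λ τ → turn τ j) (xor-cancelʳ σ (sig Π a w))) turn≡l)) w[l]≡c

  face-edge-adj : ∀ s {x y} → EIn Π s x y → Adj G x y
  face-edge-adj s (k , inj₁ (refl , refl)) = walk-adj s k
  face-edge-adj s (k , inj₂ (refl , refl)) = ~-sym (walk-adj s k)

module CyclicFaces {n : ℕ} {G : Graph n} (Π : Scheme G) (cyc : FacialWalksAreCycles Π) where
  open FaceTracing Π

  revisit : ∀ s a b → a ≤ b → wv Π s b ≡ wv Π s a → iter Π b s ≡ iter Π a s
  revisit s a b a≤b e with m≤n⇒∃[o]m+o≡n a≤b
  ... | d , refl rewrite +-comm a d =
    trans (iter-+ d a s) (cyc (iter Π a s) d (trans (wv-iter d a s) e))

  state-determined : ∀ s a b → wv Π s a ≡ wv Π s b → iter Π a s ≡ iter Π b s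
  state-determined s a b e with ≤-total a b
  ... | inj₁ a≤b = sym (revisit s a b a≤b (sym e))
  ... | inj₂ b≤a = revisit s b a b≤a e

  face-edge-neighbour : ∀ s {x y} m → EIn Π s x y → wv Π s (suc m) ≡ x →
                        y ≡ wv Π s (suc (suc m)) ⊎ y ≡ wv Π s m
  face-edge-neighbour s m (k , inj₁ (refl , refl)) x-at =
    inj₁ (cong (vertex ∘ step Π) (state-determined s k (suc m) (sym x-at)))
  face-edge-neighbour s m (k , inj₂ (refl , refl)) x-at = inj₂ (begin
    wv Π s k                         ≡⟨ sym (entered-from-step (iter Π k s)) ⟩
    entered-from (iter Π (suc k) s)  ≡⟨ cong entered-from (state-determined s (suc k) (suc m) (sym x-at)) ⟩
    entered-from (iter Π (suc m) s)  ≡⟨ entered-from-step (iter Π m s) ⟩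
    wv Π s m                         ∎)
    where open ≡-Reasoning

  not-face-edge : ∀ {s x y} m → EIn Π s x y → wv Π s (suc m) ≡ x →
                  wv Π s (suc (suc m)) ≢ y → wv Π s m ≢ y → ⊥
  not-face-edge {s} m xy x-at ≢next ≢prev =
    [ ≢next ∘ sym , ≢prev ∘ sym ]′ (face-edge-neighbour s m xy x-at)

  misplaced-edge : ∀ {s s' x y} m → SameCycle Π s s' → EIn Π s' x y → wv Π s (suc m) ≡ x →
                   wv Π s (suc (suc m)) ≢ y → wv Π s m ≢ y → ⊥
  misplaced-edge m same xy = not-face-edge m (proj₂ (same _ _) xy)

  follows-backwards : ∀ {s s'} k m → SameCycle Π s s' →
    wv Π s' k ≡ wv Π s (suc (suc m)) → wv Π s' (suc k) ≡ wv Π s (suc m) →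
    wv Π s' (suc (suc k)) ≡ wv Π s m
  follows-backwards {s} {s'} k m same e₀ e₁
    with face-edge-neighbour s m (proj₂ (same _ _) (suc k , inj₁ (refl , refl))) (sym e₁)
  ... | inj₁ forwards = ⊥-elim (no-backtrack s' k (trans e₀ (sym forwards)))
  ... | inj₂ backwards = backwards

module PolyhedralFaces {n : ℕ} {G : Graph n} (Π : Scheme G) (poly : Polyhedral Π) where
  open FaceTracing Π
  open CyclicFaces Π (proj₁ poly)

  OnBoth : State n → State n → Fin n → Set
  OnBoth s s' x = VIn Π s x × VIn Π s' x

  three-common⇒same-face : ∀ s s' {a b c} → OnBoth s s' a → OnBoth s s' b → OnBoth s s' c →
                           a ≢ b → a ≢ c → b ≢ c → ¬ ¬ SameCycle Π s s'
  three-common⇒same-face s s' {a} {b} {c} on-a on-b on-c a≢b a≢c b≢c different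
    with proj₂ poly s s' different
  ... | inj₁ disjoint = disjoint a on-a
  ... | inj₂ (inj₁ (_ , single)) = a≢b (trans (proj₁ (single a) on-a) (sym (proj₁ (single b) on-b)))
  ... | inj₂ (inj₂ (_ , _ , _ , pair , _)) =
    no-three-in-pair (proj₁ (pair a) on-a) (proj₁ (pair b) on-b) (proj₁ (pair c) on-c) a≢b a≢c b≢c

  -- Two faces can only meet in an edge, so sharing a non-adjacent pair forces coincidence.
  nonadjacent-common⇒same-face : ∀ s s' {a b} → OnBoth s s' a → OnBoth s s' b →
                                 a ≢ b → ¬ Adj G a b → ¬ ¬ SameCycle Π s s'
  nonadjacent-common⇒same-face s s' {a} {b} on-a on-b a≢b a≁b different
    with proj₂ poly s s' different
  ... | inj₁ disjoint = disjoint a on-a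
  ... | inj₂ (inj₁ (_ , single)) = a≢b (trans (proj₁ (single a) on-a) (sym (proj₁ (single b) on-b)))
  ... | inj₂ (inj₂ (_ , _ , _ , pair , xy , _))
    with distinct-in-pair (proj₁ (pair a) on-a) (proj₁ (pair b) on-b) a≢b
  ...   | inj₁ (refl , refl) = a≁b (face-edge-adj s xy)
  ...   | inj₂ (refl , refl) = a≁b (~-sym (face-edge-adj s xy))

  -- A face x₀ x₁ x₂ … x_ℓ with x_ℓ adjacent to x₁ (and x_ℓ ≠ x₂) closes up after ℓ steps:
  -- the face through x₂ x₁ x_ℓ shares three vertices with it, so x₁ x_ℓ is a face edge.
  closes-up : ∀ F ℓ → Adj G (wv Π F ℓ) (wv Π F 1) → wv Π F 2 ≢ wv Π F ℓ → iter Π ℓ F ≡ F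
  closes-up F ℓ xℓ~x₁ x₂≢xℓ with wv Π F 0 ≟ wv Π F ℓ
  ... | yes x₀≡xℓ = proj₁ poly F ℓ (sym x₀≡xℓ)
  ... | no x₀≢xℓ with angle-facial (~-sym (walk-adj F 1)) (~-sym xℓ~x₁) x₂≢xℓ
  ...   | X , X₀ , X₁ , X₂ = ⊥-elim (three-common⇒same-face F X
            ((2 , refl) , (0 , X₀)) ((1 , refl) , (1 , X₁)) ((ℓ , refl) , (2 , X₂))
            (≢-sym (adj⇒≢ (walk-adj F 1))) x₂≢xℓ (≢-sym (adj⇒≢ xℓ~x₁))
            (λ same → misplaced-edge 0 same (1 , inj₁ (X₁ , X₂)) refl x₂≢xℓ x₀≢xℓ))

module ThreePathFaces {n : ℕ} {G : Graph n} (Π : Scheme G) (poly : Polyhedral Π) where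
  open FaceTracing Π
  open CyclicFaces Π (proj₁ poly)
  open PolyhedralFaces Π poly

  data ThreePaths (u v a₀ a₁ b₀ b₁ c₀ c₁ : Fin n) : Set where
    three-paths : Path3 G u a₀ a₁ v → Path3 G u b₀ b₁ v → Path3 G u c₀ c₁ v →
                  Disjoint2 a₀ a₁ b₀ b₁ → Disjoint2 a₀ a₁ c₀ c₁ → Disjoint2 b₀ b₁ c₀ c₁ →
                  ThreePaths u v a₀ a₁ b₀ b₁ c₀ c₁

  disjoint-sym : ∀ {a b c d : Fin n} → Disjoint2 a b c d → Disjoint2 c d a b
  disjoint-sym (a≢c , a≢d , b≢c , b≢d) = ≢-sym a≢c , ≢-sym b≢c , ≢-sym a≢d , ≢-sym b≢d

  swap₁₂ : ∀ {u v a₀ a₁ b₀ b₁ c₀ c₁} → ThreePaths u v a₀ a₁ b₀ b₁ c₀ c₁ → ThreePaths u v b₀ b₁ a₀ a₁ c₀ c₁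
  swap₁₂ (three-paths A B C ab ac bc) = three-paths B A C (disjoint-sym ab) bc ac

  swap₂₃ : ∀ {u v a₀ a₁ b₀ b₁ c₀ c₁} → ThreePaths u v a₀ a₁ b₀ b₁ c₀ c₁ → ThreePaths u v a₀ a₁ c₀ c₁ b₀ b₁
  swap₂₃ (three-paths A B C ab ac bc) = three-paths A C B ac ab (disjoint-sym bc)

  u-neighbours : ∀ {u v a₀ a₁ b₀ b₁ c₀ c₁ w} → ThreePaths u v a₀ a₁ b₀ b₁ c₀ c₁ →
                 Adj G u w → OneOf w a₀ b₀ c₀
  u-neighbours (three-paths (_ , A , _) (_ , B , _) (_ , C , _) (ab , _) (ac , _) (bc , _)) =
    neighbours-exhausted A B C ab ac bc

  v-neighbours : ∀ {u v a₀ a₁ b₀ b₁ c₀ c₁ w} → ThreePaths u v a₀ a₁ b₀ b₁ c₀ c₁ →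
                 Adj G v w → OneOf w a₁ b₁ c₁
  v-neighbours (three-paths (_ , _ , _ , A) (_ , _ , _ , B) (_ , _ , _ , C)
                            (_ , _ , _ , ab) (_ , _ , _ , ac) (_ , _ , _ , bc)) =
    neighbours-exhausted (~-sym A) (~-sym B) (~-sym C) ab ac bc

  -- Consequently u and v are not adjacent.
  u≁v : ∀ {u v a₀ a₁ b₀ b₁ c₀ c₁} → ThreePaths u v a₀ a₁ b₀ b₁ c₀ c₁ → ¬ Adj G u v
  u≁v P@(three-paths ((_ , _ , _ , _ , a₀≢v , _) , _) ((_ , _ , _ , _ , b₀≢v , _) , _)
                     ((_ , _ , _ , _ , c₀≢v , _) , _) _ _ _) u~v =
    [ a₀≢v ∘ sym , [ b₀≢v ∘ sym , c₀≢v ∘ sym ]′ ]′ (u-neighbours P u~v)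

  hexagon-along : ∀ {u v a₀ a₁ b₀ b₁} → Path3 G u b₀ b₁ v → ∀ F →
    wv Π F 1 ≡ b₀ → wv Π F 2 ≡ u → wv Π F 3 ≡ a₀ → wv Π F 4 ≡ a₁ → wv Π F 5 ≡ v → wv Π F 6 ≡ b₁ →
    FacialHexagon Π u a₀ a₁ v b₁ b₀
  hexagon-along ((_ , u≢b₁ , _) , _ , b₀~b₁ , _) F refl refl refl refl refl refl =
    hexagon-from F 2 period refl refl refl refl refl (periodic 6 F period 1)
    where
    period : iter Π 6 F ≡ F
    period = closes-up F 6 (~-sym b₀~b₁) u≢b₁

  -- A face running b₀ u a₀ (positions 1–3) never reaches c₁: the face through c₁ c₀ u
  -- would share three vertices with it, making c₀ a face-neighbour of u besides b₀, a₀.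
  no-switch : ∀ {u v a₀ a₁ b₀ b₁ c₀ c₁} → ThreePaths u v a₀ a₁ b₀ b₁ c₀ c₁ → ∀ F k →
    wv Π F 1 ≡ b₀ → wv Π F 2 ≡ u → wv Π F 3 ≡ a₀ → wv Π F k ≡ c₁ → ⊥
  no-switch {u} {v} {a₀} {a₁} {b₀} {b₁} {c₀} {c₁}
    P@(three-paths ((u≢a₀ , _) , _) ((u≢b₀ , _) , _) ((_ , u≢c₁ , _) , u~c₀ , c₀~c₁ , _) _
                   (a₀≢c₀ , a₀≢c₁ , _) (b₀≢c₀ , b₀≢c₁ , _)) F k e₁ e₂ e₃ eₖ
    with angle-facial (~-sym c₀~c₁) (~-sym u~c₀) (≢-sym u≢c₁)
  ... | Z , z₀ , z₁ , z₂ = third (u-neighbours P (adj-succ Z 2 z₂))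
    where
    not-same : ¬ SameCycle Π F Z
    not-same same = misplaced-edge 1 same (1 , inj₂ (z₁ , z₂)) e₂
                      (λ q → a₀≢c₀ (trans (sym e₃) q)) (λ q → b₀≢c₀ (trans (sym e₁) q))
    third : OneOf (wv Π Z 3) a₀ b₀ c₀ → ⊥
    third (inj₁ p) = three-common⇒same-face F Z ((k , eₖ) , (0 , z₀)) ((2 , e₂) , (2 , z₂))
                       ((3 , e₃) , (3 , p)) (≢-sym u≢c₁) (≢-sym a₀≢c₁) u≢a₀ not-same
    third (inj₂ (inj₁ p)) = three-common⇒same-face F Z ((k , eₖ) , (0 , z₀)) ((2 , e₂) , (2 , z₂))
                              ((1 , e₁) , (3 , p)) (≢-sym u≢c₁) (≢-sym b₀≢c₁) u≢b₀ not-same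
    third (inj₂ (inj₂ p)) = no-backtrack Z 1 (trans z₁ (sym p))

  -- A face running u a₀ a₁ v (positions 2–5) continues along a second path at both ends,
  -- necessarily the same one, and closes up into their facial hexagon.
  face-along-path : ∀ {u v a₀ a₁ b₀ b₁ c₀ c₁} → ThreePaths u v a₀ a₁ b₀ b₁ c₀ c₁ → ∀ F →
    wv Π F 2 ≡ u → wv Π F 3 ≡ a₀ → wv Π F 4 ≡ a₁ → wv Π F 5 ≡ v →
    FacialHexagon Π u a₀ a₁ v b₁ b₀ ⊎ FacialHexagon Π u a₀ a₁ v c₁ c₀
  face-along-path {u} {v} {a₀} {a₁} {b₀} {b₁} {c₀} {c₁} P@(three-paths _ B C _ _ _) F e₂ e₃ e₄ e₅ =
    ends (u-neighbours P (adj-pred F 1 e₂)) (v-neighbours P (adj-succ F 5 e₅))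
    where
    ends : OneOf (wv Π F 1) a₀ b₀ c₀ → OneOf (wv Π F 6) a₁ b₁ c₁ →
           FacialHexagon Π u a₀ a₁ v b₁ b₀ ⊎ FacialHexagon Π u a₀ a₁ v c₁ c₀
    ends (inj₁ p) _ = ⊥-elim (no-backtrack F 1 (trans p (sym e₃)))
    ends _ (inj₁ q) = ⊥-elim (no-backtrack F 4 (trans e₄ (sym q)))
    ends (inj₂ (inj₁ p)) (inj₂ (inj₁ q)) = inj₁ (hexagon-along B F p e₂ e₃ e₄ e₅ q)
    ends (inj₂ (inj₂ p)) (inj₂ (inj₂ q)) = inj₂ (hexagon-along C F p e₂ e₃ e₄ e₅ q)
    ends (inj₂ (inj₁ p)) (inj₂ (inj₂ q)) = ⊥-elim (no-switch P F 6 p e₂ e₃ q)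
    ends (inj₂ (inj₂ p)) (inj₂ (inj₁ q)) = ⊥-elim (no-switch (swap₂₃ P) F 6 p e₂ e₃ q)

  -- On a face running u a₀ b₁ (positions 2–4), a₀ has face-neighbours u and b₁, so a face
  -- entering a₀ from a₁ is a different face.
  enters-a₀-from-a₁ : ∀ {u v a₀ a₁ b₀ b₁ c₀ c₁} → ThreePaths u v a₀ a₁ b₀ b₁ c₀ c₁ → ∀ F S →
    wv Π F 2 ≡ u → wv Π F 3 ≡ a₀ → wv Π F 4 ≡ b₁ → wv Π S 0 ≡ a₁ → wv Π S 1 ≡ a₀ → ¬ SameCycle Π F S
  enters-a₀-from-a₁ (three-paths ((_ , u≢a₁ , _) , _) _ _ (_ , _ , _ , a₁≢b₁) _ _) F S e₂ e₃ e₄ s₀ s₁ same =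
    misplaced-edge 2 same (0 , inj₂ (s₀ , s₁)) e₃
      (λ q → a₁≢b₁ (trans (sym q) e₄)) (λ q → u≢a₁ (trans (sym e₂) q))

  -- A face F running c₀ u a₀ b₁ (positions 1–4) and a face Z₂ running a₁ a₀ b₁ b₀ cannot
  -- coexist: the face through a₁ a₀ u shares three vertices with Z₂ or with F, and either
  -- coincidence puts an edge where the other face does not have it.
  crossing-corner : ∀ {u v a₀ a₁ b₀ b₁ c₀ c₁} → ThreePaths u v a₀ a₁ b₀ b₁ c₀ c₁ → ∀ F Z₂ →
    wv Π F 1 ≡ c₀ → wv Π F 2 ≡ u → wv Π F 3 ≡ a₀ → wv Π F 4 ≡ b₁ →
    wv Π Z₂ 0 ≡ a₁ → wv Π Z₂ 1 ≡ a₀ → wv Π Z₂ 2 ≡ b₁ → wv Π Z₂ 3 ≡ b₀ → ⊥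
  crossing-corner {u} {v} {a₀} {a₁} {b₀} {b₁} {c₀} {c₁}
    P@(three-paths ((u≢a₀ , u≢a₁ , _ , a₀≢a₁ , _) , u~a₀ , a₀~a₁ , _) ((_ , u≢b₁ , _) , _) ((u≢c₀ , _) , _)
                   (a₀≢b₀ , _ , a₁≢b₀ , a₁≢b₁) (a₀≢c₀ , _) _)
    F Z₂ e₁ e₂ e₃ e₄ w₀ w₁ w₂ w₃
    with angle-facial (~-sym a₀~a₁) (~-sym u~a₀) (≢-sym u≢a₁)
  ... | Z , y₀ , y₁ , y₂ = third (u-neighbours P (adj-succ Z 2 y₂))
    where
    third : OneOf (wv Π Z 3) a₀ b₀ c₀ → ⊥
    third (inj₁ p) = no-backtrack Z 1 (trans y₁ (sym p))
    third (inj₂ (inj₁ p)) =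
      three-common⇒same-face Z Z₂ ((0 , y₀) , (0 , w₀)) ((1 , y₁) , (1 , w₁)) ((3 , p) , (3 , w₃))
        (≢-sym a₀≢a₁) a₁≢b₀ a₀≢b₀
        (λ same → misplaced-edge 0 same (1 , inj₁ (w₁ , w₂)) y₁
                    (λ q → u≢b₁ (trans (sym y₂) q)) (λ q → a₁≢b₁ (trans (sym y₀) q)))
    third (inj₂ (inj₂ p)) =
      three-common⇒same-face F Z ((3 , e₃) , (1 , y₁)) ((2 , e₂) , (2 , y₂)) ((1 , e₁) , (3 , p))
        (≢-sym u≢a₀) a₀≢c₀ u≢c₀ (enters-a₀-from-a₁ P F Z e₂ e₃ e₄ y₀ y₁)

  -- The face
  -- Z₂ through a₁ a₀ b₁ differs from F (`enters-a₀-from-a₁`), yet after b₁ it visits v,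
  -- sharing a₀ b₁ v with F, or b₀; then F enters u from b₀, sharing a₀ b₁ b₀ with Z₂, or
  -- from c₀, which `crossing-corner` excludes.
  no-crossing : ∀ {u v a₀ a₁ b₀ b₁ c₀ c₁} → ThreePaths u v a₀ a₁ b₀ b₁ c₀ c₁ → ∀ F →
    wv Π F 2 ≡ u → wv Π F 3 ≡ a₀ → wv Π F 4 ≡ b₁ → wv Π F 5 ≡ v → ⊥
  no-crossing {u} {v} {a₀} {a₁} {b₀} {b₁} {c₀} {c₁}
    P@(three-paths ((_ , _ , _ , _ , a₀≢v , _) , _ , a₀~a₁ , _)
                   ((_ , _ , _ , b₀≢b₁ , b₀≢v , b₁≢v) , _ , b₀~b₁ , b₁~v) _
                   (a₀≢b₀ , a₀≢b₁ , _ , a₁≢b₁) _ _) F e₂ e₃ e₄ e₅ =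
    from-Z₂ (angle-facial (~-sym a₀~a₁) a₀~b₁ a₁≢b₁)
    where
    a₀~b₁ : Adj G a₀ b₁
    a₀~b₁ = subst₂ (Adj G) e₃ e₄ (walk-adj F 3)
    from-Z₂ : FacialAngle a₁ a₀ b₁ → ⊥
    from-Z₂ (Z₂ , w₀ , w₁ , w₂) =
      third (neighbours-exhausted b₁~v (~-sym b₀~b₁) (~-sym a₀~b₁) (≢-sym b₀≢v) (≢-sym a₀≢v) (≢-sym a₀≢b₀)
               (adj-succ Z₂ 2 w₂))
      where
      avoid : ¬ SameCycle Π F Z₂
      avoid = enters-a₀-from-a₁ P F Z₂ e₂ e₃ e₄ w₀ w₁
      before-u : wv Π Z₂ 3 ≡ b₀ → OneOf (wv Π F 1) a₀ b₀ c₀ → ⊥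
      before-u _ (inj₁ q) = no-backtrack F 1 (trans q (sym e₃))
      before-u p (inj₂ (inj₁ q)) =
        three-common⇒same-face F Z₂ ((3 , e₃) , (1 , w₁)) ((4 , e₄) , (2 , w₂)) ((1 , q) , (3 , p))
          a₀≢b₁ a₀≢b₀ (≢-sym b₀≢b₁) avoid
      before-u p (inj₂ (inj₂ q)) = crossing-corner P F Z₂ q e₂ e₃ e₄ w₀ w₁ w₂ p
      third : OneOf (wv Π Z₂ 3) v b₀ a₀ → ⊥
      third (inj₁ p) =
        three-common⇒same-face F Z₂ ((3 , e₃) , (1 , w₁)) ((4 , e₄) , (2 , w₂)) ((5 , e₅) , (3 , p))
          a₀≢b₁ a₀≢v b₁≢v avoid
      third (inj₂ (inj₁ p)) = before-u p (u-neighbours P (adj-pred F 1 e₂))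
      third (inj₂ (inj₂ p)) = no-backtrack Z₂ 1 (trans w₁ (sym p))

  -- The facial hexagon u a b v d c is also traversed in the opposite direction: the face
  -- through u c d shares three vertices with it and so follows it backwards.  Since the
  -- positions reached are decidable, the doubly negated coincidence suffices.
  hexagon-reverse : ∀ {u a b v d c} → FacialHexagon Π u a b v d c → u ≢ c → u ≢ d → c ≢ d →
                    FacialHexagon Π u c d v b a
  hexagon-reverse {u} {a} {b} {v} {d} {c} (h , h₀ , h₁ , h₂ , h₃ , h₄ , h₅ , per) u≢c u≢d c≢d
    = from-r (angle-facial (~-sym c~u) (~-sym d~c) u≢d)
    where
    c~u : Adj G c u
    c~u = subst₂ (Adj G) h₅ (trans (periodic 6 h per 0) h₀) (walk-adj h 5)
    d~c : Adj G d c
    d~c = subst₂ (Adj G) h₄ h₅ (walk-adj h 4)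
    from-r : FacialAngle u c d → FacialHexagon Π u c d v b a
    from-r (r , r₀ , r₁ , r₂) = closing (decidable-stable later? (¬¬-map later same))
      where
      Later : Set
      Later = wv Π r 3 ≡ v × wv Π r 4 ≡ b × wv Π r 5 ≡ a × wv Π r 6 ≡ u
      later? : Dec Later
      later? = (wv Π r 3 ≟ v) ×-dec (wv Π r 4 ≟ b) ×-dec (wv Π r 5 ≟ a) ×-dec (wv Π r 6 ≟ u)
      same : ¬ ¬ SameCycle Π h r
      same = three-common⇒same-face h r ((0 , h₀) , (0 , r₀)) ((5 , h₅) , (1 , r₁)) ((4 , h₄) , (2 , r₂))
               u≢c u≢d c≢d
      later : SameCycle Π h r → Later
      later same = trans q₃ h₃ , trans q₄ h₂ , trans q₅ h₁ , trans q₆ h₀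
        where
        q₂ = trans r₂ (sym h₄)
        q₃ = follows-backwards 1 3 same (trans r₁ (sym h₅)) q₂
        q₄ = follows-backwards 2 2 same q₂ q₃
        q₅ = follows-backwards 3 1 same q₃ q₄
        q₆ = follows-backwards 4 0 same q₄ q₅
      closing : Later → FacialHexagon Π u c d v b a
      closing (r₃ , r₄ , r₅ , r₆) = r , r₀ , r₁ , r₂ , r₃ , r₄ , r₅ , proj₁ poly r 6 (trans r₆ (sym r₀))

  -- A facial hexagon formed by two paths (u a b v) and (u c d v) gives [uv] exactly the
  -- two scaffold witnesses (a, b) and (c, d): any witnessing face shares the non-adjacent
  -- u, v with the hexagon, hence is the hexagon, and its edges at u and v must be hexagon edges.
  hexagon⇒double-scaffold : ∀ {u a b v c d} → Path3 G u a b v → Path3 G u c d v → Disjoint2 a b c d →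
    ¬ Adj G u v → FacialHexagon Π u a b v d c → IsDoubleScaffoldEdge Π u v
  hexagon⇒double-scaffold {u} {a} {b} {v} {c} {d}
    P@((_ , u≢b , u≢v , _) , _) Q@((u≢c , u≢d , _ , c≢d , _) , _) (a≢c , _ , _ , b≢d) u≁v
    H@(h , h₀ , h₁ , h₂ , h₃ , h₄ , h₅ , per) =
    u≢v , (a , b) , (c , d) , (a≢c ∘ cong proj₁) , (P , h , h₀ , h₁ , h₂ , h₃) ,
      reversed (hexagon-reverse H u≢c u≢d c≢d) , only-two
    where
    h₆ : wv Π h 6 ≡ u
    h₆ = trans (periodic 6 h per 0) h₀
    h₇ : wv Π h 7 ≡ a
    h₇ = trans (periodic 6 h per 1) h₁
    reversed : FacialHexagon Π u c d v b a → ScaffoldWitness Π u v (c , d)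
    reversed (r , r₀ , r₁ , r₂ , r₃ , _) = Q , r , r₀ , r₁ , r₂ , r₃
    only-two : ∀ w → ScaffoldWitness Π u v w → w ≡ (a , b) ⊎ w ≡ (c , d)
    only-two (b' , c') (_ , s , s₀ , s₁ , s₂ , s₃) =
      decidable-stable (≡-dec _≟_ _≟_ (b' , c') (a , b) ⊎-dec ≡-dec _≟_ _≟_ (b' , c') (c , d))
        λ neither → nonadjacent-common⇒same-face h s ((0 , h₀) , (0 , s₀)) ((3 , h₃) , (3 , s₃)) u≢v u≁v
          λ same → classify neither (b'-position same) (c'-position same)
                                    (proj₂ (same b' c') (1 , inj₁ (s₁ , s₂)))
      where
      -- b' follows u on the hexagon, so it is a or c
      b'-position : SameCycle Π h s → b' ≡ a ⊎ b' ≡ c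
      b'-position same = Sum.map (λ p → trans p h₇) (λ p → trans p h₅)
        (face-edge-neighbour h 5 (proj₂ (same u b') (0 , inj₁ (s₀ , s₁))) h₆)
      -- c' precedes v on the hexagon, so it is d or b
      c'-position : SameCycle Π h s → c' ≡ d ⊎ c' ≡ b
      c'-position same = Sum.map (λ p → trans p h₄) (λ p → trans p h₂)
        (face-edge-neighbour h 2 (proj₂ (same v c') (2 , inj₂ (s₂ , s₃))) h₃)
      -- and b' c' is a hexagon edge, which rules out the mixed choices (a, d) and (c, b)
      classify : ¬ ((b' , c') ≡ (a , b) ⊎ (b' , c') ≡ (c , d)) →
                 b' ≡ a ⊎ b' ≡ c → c' ≡ d ⊎ c' ≡ b → EIn Π h b' c' → ⊥
      classify neither (inj₁ p) (inj₂ q) _ = neither (inj₁ (cong₂ _,_ p q))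
      classify neither (inj₂ p) (inj₁ q) _ = neither (inj₂ (cong₂ _,_ p q))
      classify _ (inj₁ p) (inj₁ q) b'c' = not-face-edge 0 b'c' (trans h₁ (sym p))
        (λ t → b≢d (trans (sym h₂) (trans t q))) (λ t → u≢d (trans (sym h₀) (trans t q)))
      classify _ (inj₂ p) (inj₂ q) b'c' = not-face-edge 4 b'c' (trans h₅ (sym p))
        (λ t → u≢b (trans (sym h₆) (trans t q))) (λ t → b≢d (sym (trans (sym h₄) (trans t q))))

  SomePairFacial : Fin n → Fin n → Fin n → Fin n → Fin n → Fin n → Fin n → Fin n → Set
  SomePairFacial u v t₀ t₁ t₂ t₃ t₄ t₅ =
    FacialHexagon Π u t₀ t₁ v t₃ t₂ ⊎ FacialHexagon Π u t₀ t₁ v t₅ t₄ ⊎ FacialHexagon Π u t₂ t₃ v t₅ t₄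

  -- A face running u b c v (positions 2–5) has b, c on the same path (`no-crossing`) and
  -- then closes up with a second path (`face-along-path`).
  facial-hexagon-through : ∀ {u v t₀ t₁ t₂ t₃ t₄ t₅} → ThreePaths u v t₀ t₁ t₂ t₃ t₄ t₅ → ∀ F →
    wv Π F 2 ≡ u → wv Π F 5 ≡ v → SomePairFacial u v t₀ t₁ t₂ t₃ t₄ t₅
  facial-hexagon-through {u} {v} {t₀} {t₁} {t₂} {t₃} {t₄} {t₅}
    P₁₂₃@(three-paths ((u≢t₀ , u≢t₁ , _ , t₀≢t₁ , _) , _) ((u≢t₂ , u≢t₃ , _ , t₂≢t₃ , _) , _) _ _ _ _)
    F e₂ e₅ =
    ends (u-neighbours P₁₂₃ (adj-succ F 2 e₂)) (v-neighbours P₁₂₃ (adj-pred F 4 e₅))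
    where
    P₁₃₂ = swap₂₃ P₁₂₃
    P₂₁₃ = swap₁₂ P₁₂₃
    P₂₃₁ = swap₂₃ P₂₁₃
    P₃₁₂ = swap₁₂ P₁₃₂
    P₃₂₁ = swap₂₃ P₃₁₂
    Goal = SomePairFacial u v t₀ t₁ t₂ t₃ t₄ t₅
    from₁ : FacialHexagon Π u t₀ t₁ v t₃ t₂ ⊎ FacialHexagon Π u t₀ t₁ v t₅ t₄ → Goal
    from₁ = Sum.map₂ inj₁
    from₂ : FacialHexagon Π u t₂ t₃ v t₁ t₀ ⊎ FacialHexagon Π u t₂ t₃ v t₅ t₄ → Goal
    from₂ = [ (λ H → inj₁ (hexagon-reverse H u≢t₀ u≢t₁ t₀≢t₁)) , inj₂ ∘ inj₂ ]′
    from₃ : FacialHexagon Π u t₄ t₅ v t₁ t₀ ⊎ FacialHexagon Π u t₄ t₅ v t₃ t₂ → Goal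
    from₃ = [ (λ H → inj₂ (inj₁ (hexagon-reverse H u≢t₀ u≢t₁ t₀≢t₁))) ,
              (λ H → inj₂ (inj₂ (hexagon-reverse H u≢t₂ u≢t₃ t₂≢t₃))) ]′
    ends : OneOf (wv Π F 3) t₀ t₂ t₄ → OneOf (wv Π F 4) t₁ t₃ t₅ → Goal
    ends (inj₁ p)        (inj₁ q)        = from₁ (face-along-path P₁₂₃ F e₂ p q e₅)
    ends (inj₂ (inj₁ p)) (inj₂ (inj₁ q)) = from₂ (face-along-path P₂₁₃ F e₂ p q e₅)
    ends (inj₂ (inj₂ p)) (inj₂ (inj₂ q)) = from₃ (face-along-path P₃₁₂ F e₂ p q e₅)
    ends (inj₁ p)        (inj₂ (inj₁ q)) = ⊥-elim (no-crossing P₁₂₃ F e₂ p q e₅)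
    ends (inj₁ p)        (inj₂ (inj₂ q)) = ⊥-elim (no-crossing P₁₃₂ F e₂ p q e₅)
    ends (inj₂ (inj₁ p)) (inj₁ q)        = ⊥-elim (no-crossing P₂₁₃ F e₂ p q e₅)
    ends (inj₂ (inj₁ p)) (inj₂ (inj₂ q)) = ⊥-elim (no-crossing P₂₃₁ F e₂ p q e₅)
    ends (inj₂ (inj₂ p)) (inj₁ q)        = ⊥-elim (no-crossing P₃₁₂ F e₂ p q e₅)
    ends (inj₂ (inj₂ p)) (inj₂ (inj₁ q)) = ⊥-elim (no-crossing P₃₂₁ F e₂ p q e₅)

  -- The face of a scaffold witness, rewound by two steps, runs u b c v at positions 2–5.
  scaffold⇒facial-hexagon : ∀ {u v t₀ t₁ t₂ t₃ t₄ t₅ b c} → ThreePaths u v t₀ t₁ t₂ t₃ t₄ t₅ →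
    FacialSubwalk Π u b c v → SomePairFacial u v t₀ t₁ t₂ t₃ t₄ t₅
  scaffold⇒facial-hexagon {u} {v} {t₀} {t₁} {t₂} {t₃} {t₄} {t₅} P (s , s₀ , _ , _ , s₃) =
    from-rewound (rewind 2 s)
    where
    from-rewound : ∃[ F ] (∀ k → wv Π F (2 + k) ≡ wv Π s k) → SomePairFacial u v t₀ t₁ t₂ t₃ t₄ t₅
    from-rewound (F , F≈s) = facial-hexagon-through P F (trans (F≈s 0) s₀) (trans (F≈s 3) s₃)

  some-hexagon⇒double-scaffold : ∀ {u v t₀ t₁ t₂ t₃ t₄ t₅} → ThreePaths u v t₀ t₁ t₂ t₃ t₄ t₅ →
    SomePairFacial u v t₀ t₁ t₂ t₃ t₄ t₅ → IsDoubleScaffoldEdge Π u v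
  some-hexagon⇒double-scaffold P@(three-paths A B C ab ac bc) =
    [ hexagon⇒double-scaffold A B ab (u≁v P) ,
      [ hexagon⇒double-scaffold A C ac (u≁v P) , hexagon⇒double-scaffold B C bc (u≁v P) ]′ ]′

proposition11 : ∀ {n : ℕ} (G : Graph n) → Cubic G → Connected G →
    (Π : Scheme G) → Polyhedral Π →
    ∀ (u v t₀ t₁ t₂ t₃ t₄ t₅ : Fin n) →
    Path3 G u t₀ t₁ v → Path3 G u t₂ t₃ v → Path3 G u t₄ t₅ v →
    Disjoint2 t₀ t₁ t₂ t₃ → Disjoint2 t₀ t₁ t₄ t₅ → Disjoint2 t₂ t₃ t₄ t₅ →
    IsScaffoldEdge Π u v →
    IsDoubleScaffoldEdge Π u v ×
    (FacialHexagon Π u t₀ t₁ v t₃ t₂ ⊎ FacialHexagon Π u t₀ t₁ v t₅ t₄ ⊎ FacialHexagon Π u t₂ t₃ v t₅ t₄)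
proposition11 G _ _ Π poly u v t₀ t₁ t₂ t₃ t₄ t₅ P₁ P₂ P₃ d₁₂ d₁₃ d₂₃ (_ , _ , _ , witness-face) =
  some-hexagon⇒double-scaffold paths hexagon , hexagon
  where
  open ThreePathFaces Π poly
  paths = three-paths P₁ P₂ P₃ d₁₂ d₁₃ d₂₃
  hexagon = scaffold⇒facial-hexagon paths witness-face
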